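{- Let $(G,\Sigma,\chi,w)$ be an instance of Decoder Retrieval and let $\{a,b\}$ be a one-sided letter pair such that $w[a,b]$ contains only one $a$-run and only one $b$-run. Then the instance has no solution.
   Context: An instance of Decoder Retrieval consists of a finite simple graph $G=(V,E)$, a finite alphabet $\Sigma$, a coloring $\chi\colon V\to\Sigma$ and a word $w\in\Sigma^{|V|}$, where for every $a\in\Sigma$ the set $V_a=\chi^{ -1}(a)$ is non-empty and $w$ contains $a$ exactly $|V_a|$ times. A set $\mathcal{D}\subseteq\Sigma^2$ is a solution if there is a graph isomorphism $f$ from $G$ to the letter graph $G(\mathcal{D},w)$ with $w_{f(v)}=\chi(v)$ for all $v$, where $G(\mathcal{D},w)$ has vertex set $\{1,\dots,|w|\}$ and edges $\{i,j\}$ for $i<j$ with $w_iw_j\in\mathcal{D}$. $E(X,Y)$ denotes the set of edges with one endpoint in $X$ and one in $Y$; a pair $\{a,b\}$ of distinct letters is one-sided if $0<|E(V_a,V_b)|<|V_a|\cdot|V_b|$. For $\Sigma'\subseteq\Sigma$, $w[\Sigma']$ is the maximal subsequence of $w$ consisting of the letters in $\Sigma'$ (and $w[a,b]=w[\{a,b\}]$). A $c$-run of a word is a maximal non-empty factor consisting only of the letter $c$. -}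

module Defs where

open import Data.Nat using (ℕ; zero; suc; _+_; _*_; _<_)
open import Data.Fin using (Fin; _≟_) renaming (_<_ to _<ᶠ_)
open import Data.Fin.Properties using ()
open import Data.Bool using (Bool; true; false; if_then_else_; _∧_; _∨_; not)
open import Data.List using (List; []; _∷_; tabulate; filter; allFin; cartesianProduct)
open import Data.Product using (_×_; _,_; Σ; ∃; proj₁; proj₂)
open import Data.Sum using (_⊎_)
open import Data.Empty using (⊥)
open import Relation.Nullary.Decidable using (⌊_⌋)
open import Relation.Binary.PropositionalEquality using (_≡_)
open import Function.Bundles using (_↔_; Inverse)
open import Function.Bundles using (_⇔_)

_==_ : ∀ {k} → Fin k → Fin k → Bool
x == y = ⌊ x ≟ y ⌋

countB : ∀ {A : Set} → (A → Bool) → List A → ℕ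
countB p [] = zero
countB p (x ∷ xs) = if p x then suc (countB p xs) else countB p xs

record SimpleGraph (n : ℕ) : Set where
  field
    adj  : Fin n → Fin n → Bool
    sym  : ∀ u v → adj u v ≡ adj v u
    irrefl : ∀ v → adj v v ≡ false
open SimpleGraph public

classSize : ∀ {n k} → (Fin n → Fin k) → Fin k → ℕ
classSize {n} χ a = countB (λ v → χ v == a) (allFin n)

occ : ∀ {n k} → (Fin n → Fin k) → Fin k → ℕ
occ {n} w a = countB (λ i → w i == a) (allFin n)

record Instance : Set where
  field
    n k   : ℕ
    G     : SimpleGraph n
    χ     : Fin n → Fin k
    w     : Fin n → Fin k
    nonempty : ∀ (a : Fin k) → ∃ λ v → χ v ≡ a
    counts   : ∀ (a : Fin k) → occ w a ≡ classSize χ a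
open Instance public

-- |E(V_a, V_b)| for a ≠ b : number of (u,v) with χ u = a, χ v = b, uv ∈ E
edgesBetween : ∀ {n k} → SimpleGraph n → (Fin n → Fin k) → Fin k → Fin k → ℕ
edgesBetween {n} G χ a b =
  countB (λ p → (χ (proj₁ p) == a) ∧ (χ (proj₂ p) == b) ∧ adj G (proj₁ p) (proj₂ p))
         (cartesianProduct (allFin n) (allFin n))

OneSided : (I : Instance) → Fin (k I) → Fin (k I) → Set
OneSided I a b =
  (a ≡ b → ⊥) × (0 < edgesBetween (G I) (χ I) a b)
              × (edgesBetween (G I) (χ I) a b < classSize (χ I) a * classSize (χ I) b)

-- Letter graph G(D,w): vertices Fin n, edge {i,j} (i<j) iff w_i w_j ∈ D.
-- D ⊆ Σ² is given by its (boolean) characteristic function.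
LetterAdj : ∀ {n k} → (Fin k → Fin k → Bool) → (Fin n → Fin k) → Fin n → Fin n → Set
LetterAdj D w i j = (i <ᶠ j × D (w i) (w j) ≡ true) ⊎ (j <ᶠ i × D (w j) (w i) ≡ true)

IsSolution : (I : Instance) → (Fin (k I) → Fin (k I) → Bool) → Set
IsSolution I D =
  Σ (Fin (n I) ↔ Fin (n I)) λ f →
    (∀ u v → (adj (G I) u v ≡ true) ⇔ LetterAdj D (w I) (Inverse.to f u) (Inverse.to f v))
    × (∀ v → w I (Inverse.to f v) ≡ χ I v)

HasSolution : Instance → Set
HasSolution I = ∃ λ D → IsSolution I D

wordList : ∀ {n k} → (Fin n → Fin k) → List (Fin k)
wordList w = tabulate w

restrict2 : ∀ {k} → List (Fin k) → Fin k → Fin k → List (Fin k)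
restrict2 [] a b = []
restrict2 (x ∷ xs) a b =
  if (x == a) ∨ (x == b) then x ∷ restrict2 xs a b else restrict2 xs a b

-- number of c-runs (maximal non-empty factors of c's); the flag records
-- whether the previous letter was c
runsFrom : ∀ {k} → Fin k → Bool → List (Fin k) → ℕ
runsFrom c prev [] = zero
runsFrom c prev (x ∷ xs) =
  if x == c
  then (if prev then runsFrom c true xs else suc (runsFrom c true xs))
  else runsFrom c false xs

runs : ∀ {k} → Fin k → List (Fin k) → ℕ
runs c xs = runsFrom c false xs

-- If w[a,b] has a single a-run and a single b-run, then every a of w lies on
-- the same side of every b.  In a letter graph the adjacency of an a-position
-- and a b-position depends only on their order and on whether ab (resp. ba)
-- lies in D, so either all or none of the a–b pairs are adjacent.  A solution
-- would transport this to G, contradicting one-sidedness of {a,b}.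
module Submission where

open import Defs
open import Data.Fin using (Fin)
open import Data.Product using (_×_)
open import Relation.Binary.PropositionalEquality using (_≡_)
open import Relation.Nullary using (¬_)

open import Data.Bool using (Bool; true; false; if_then_else_; _∧_; _∨_)
open import Data.Bool.Properties using (∨-zeroʳ; ∧-conicalˡ; ∧-conicalʳ)
open import Data.Empty using (⊥-elim)
open import Data.Fin using (zero; suc; _≟_) renaming (_<_ to _<ᶠ_)
open import Data.Fin.Properties using (<-cmp)
open import Data.List using (List; []; _∷_; [_]; _++_; map; tabulate; allFin; cartesianProduct)
open import Data.List.Relation.Binary.Sublist.Propositional using (_⊆_; []; _∷_; _∷ʳ_; minimum)
open import Data.List.Relation.Unary.All using (All; []; _∷_)
open import Data.Nat using (ℕ; suc; _+_; _*_; _≤_; _<_; z≤n; s≤s)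
open import Data.Nat.Properties using (≤-refl; ≤-trans; ≤-pred; n≤1+n; <-irrefl)
open import Data.Product using (∃; ∃₂; _,_; proj₁; proj₂)
open import Data.Sum using (_⊎_; inj₁; inj₂)
open import Function using (case_of_)
open import Function.Bundles using (Inverse; Equivalence)
open import Relation.Binary.Definitions using (tri<; tri≈; tri>)
open import Relation.Binary.PropositionalEquality
  using (refl; trans; cong; cong₂; subst; subst₂; _≢_; ≢-sym)
open import Relation.Nullary using (yes; no)
import Relation.Binary.PropositionalEquality as ≡

private variable
  A B : Set
  m s : ℕ

==-refl : (x : Fin s) → (x == x) ≡ true
==-refl x with x ≟ x
... | yes _   = refl
... | no x≢x = ⊥-elim (x≢x refl)

==⇒≡ : {x y : Fin s} → (x == y) ≡ true → x ≡ y
==⇒≡ {x = x} {y} e with x ≟ y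
... | yes x≡y = x≡y

≢⇒==false : {x y : Fin s} → x ≢ y → (x == y) ≡ false
≢⇒==false {x = x} {y} x≢y with x ≟ y
... | yes x≡y = ⊥-elim (x≢y x≡y)
... | no _    = refl

true-∧-false : {x y : Bool} → x ≡ true → (x ∧ y) ≡ false → y ≡ false
true-∧-false refl e = e

countB-++ : (p : A → Bool) (xs ys : List A) →
            countB p (xs ++ ys) ≡ countB p xs + countB p ys
countB-++ p [] ys = refl
countB-++ p (x ∷ xs) ys with p x
... | true  = cong suc (countB-++ p xs ys)
... | false = countB-++ p xs ys

countB-map : (p : B → Bool) (h : A → B) (xs : List A) →
             countB p (map h xs) ≡ countB (λ x → p (h x)) xs
countB-map p h [] = refl
countB-map p h (x ∷ xs) with p (h x)
... | true  = cong suc (countB-map p h xs)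
... | false = countB-map p h xs

countB-false : (xs : List A) → countB (λ _ → false) xs ≡ 0
countB-false [] = refl
countB-false (x ∷ xs) = countB-false xs

countB-cartesianProduct : (p : A → Bool) (q : B → Bool) (xs : List A) (ys : List B) →
  countB (λ xy → p (proj₁ xy) ∧ q (proj₂ xy)) (cartesianProduct xs ys)
    ≡ countB p xs * countB q ys
countB-cartesianProduct p q [] ys = refl
countB-cartesianProduct p q (x ∷ xs) ys =
  trans (countB-++ _ (map (x ,_) ys) (cartesianProduct xs ys))
        (trans (cong₂ _+_ (countB-map _ (x ,_) ys) (countB-cartesianProduct p q xs ys))
               (row (p x)))
  where
    row : (c : Bool) → countB (λ y → c ∧ q y) ys + countB p xs * countB q ys
                     ≡ (if c then suc (countB p xs) else countB p xs) * countB q ys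
    row true  = refl
    row false = cong (_+ countB p xs * countB q ys) (countB-false ys)

countB-pos⇒∃ : (p : A → Bool) (xs : List A) → 0 < countB p xs → ∃ λ x → p x ≡ true
countB-pos⇒∃ p (x ∷ xs) pos with p x in px
... | true  = x , px
... | false = countB-pos⇒∃ p xs pos

countB<countB⇒∃ : (p q : A → Bool) (xs : List A) → countB p xs < countB q xs →
                  ∃ λ x → q x ≡ true × p x ≡ false
countB<countB⇒∃ p q (x ∷ xs) lt with p x in px | q x in qx
... | true  | true  = countB<countB⇒∃ p q xs (≤-pred lt)
... | false | true  = x , qx , px
... | true  | false = countB<countB⇒∃ p q xs (≤-trans (n≤1+n _) lt)
... | false | false = countB<countB⇒∃ p q xs lt

module _ (G : SimpleGraph m) (χ : Fin m → Fin s) (a b : Fin s) where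

  edgesBetween-pos⇒edge : 0 < edgesBetween G χ a b →
    ∃₂ λ u v → χ u ≡ a × χ v ≡ b × adj G u v ≡ true
  edgesBetween-pos⇒edge pos with countB-pos⇒∃ _ (cartesianProduct (allFin m) (allFin m)) pos
  ... | (u , v) , e =
    u , v , ==⇒≡ (∧-conicalˡ _ _ e) , ==⇒≡ (∧-conicalˡ _ _ v∈b∧uv) , ∧-conicalʳ _ _ v∈b∧uv
    where
      v∈b∧uv : ((χ v == b) ∧ adj G u v) ≡ true
      v∈b∧uv = ∧-conicalʳ (χ u == a) _ e

  edgesBetween<⇒non-edge : edgesBetween G χ a b < classSize χ a * classSize χ b →
    ∃₂ λ u v → χ u ≡ a × χ v ≡ b × adj G u v ≡ false
  edgesBetween<⇒non-edge lt
    with countB<countB⇒∃ _ _ (cartesianProduct (allFin m) (allFin m))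
           (subst (edgesBetween G χ a b <_)
             (≡.sym (countB-cartesianProduct (λ u → χ u == a) (λ v → χ v == b) (allFin m) (allFin m)))
             lt)
  ... | (u , v) , ab , ¬e = u , v , ==⇒≡ u∈a , ==⇒≡ v∈b , true-∧-false v∈b (true-∧-false u∈a ¬e)
    where
      u∈a : (χ u == a) ≡ true
      u∈a = ∧-conicalˡ _ _ ab
      v∈b : (χ v == b) ≡ true
      v∈b = ∧-conicalʳ _ _ ab

runsFrom-true≤false : (c : Fin s) (xs : List (Fin s)) → runsFrom c true xs ≤ runsFrom c false xs
runsFrom-true≤false c [] = z≤n
runsFrom-true≤false c (x ∷ xs) with x == c
... | true  = n≤1+n _
... | false = ≤-refl

runsFrom-false≤1+true : (c : Fin s) (xs : List (Fin s)) →
                        runsFrom c false xs ≤ suc (runsFrom c true xs)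
runsFrom-false≤1+true c [] = z≤n
runsFrom-false≤1+true c (x ∷ xs) with x == c
... | true  = ≤-refl
... | false = n≤1+n _

-- Deleting a c shrinks or removes a run, deleting another letter can only merge two runs.
runsFrom-mono-⊆ : (c : Fin s) (prev : Bool) {xs ys : List (Fin s)} →
                  xs ⊆ ys → runsFrom c prev xs ≤ runsFrom c prev ys
runsFrom-mono-⊆ c prev [] = ≤-refl
runsFrom-mono-⊆ c prev (_∷ʳ_ {xs = xs} y sub) with y == c | prev
... | true  | true  = runsFrom-mono-⊆ c true sub
... | true  | false = ≤-trans (runsFrom-false≤1+true c xs) (s≤s (runsFrom-mono-⊆ c true sub))
... | false | true  = ≤-trans (runsFrom-true≤false c xs) (runsFrom-mono-⊆ c false sub)
... | false | false = runsFrom-mono-⊆ c false sub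
runsFrom-mono-⊆ c prev (_∷_ {x = x} refl sub) with x == c | prev
... | true  | true  = runsFrom-mono-⊆ c true sub
... | true  | false = s≤s (runsFrom-mono-⊆ c true sub)
... | false | _     = runsFrom-mono-⊆ c false sub

runs-cdc : {c d : Fin s} → d ≢ c → runs c (c ∷ d ∷ c ∷ []) ≡ 2
runs-cdc {c = c} d≢c rewrite ==-refl c | ≢⇒==false d≢c = refl

single-run⇒¬cdc⊆ : {c d : Fin s} {xs : List (Fin s)} → runs c xs ≡ 1 → d ≢ c →
                   ¬ (c ∷ d ∷ c ∷ [] ⊆ xs)
single-run⇒¬cdc⊆ {c = c} one d≢c cdc =
  <-irrefl refl (subst₂ _≤_ (runs-cdc d≢c) one (runsFrom-mono-⊆ c false cdc))

⊆-tabulate₁ : (w : Fin m → A) {x : A} {i : Fin m} → w i ≡ x → [ x ] ⊆ tabulate w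
⊆-tabulate₁ w {i = zero}  wi = ≡.sym wi ∷ minimum _
⊆-tabulate₁ w {i = suc i} wi = w zero ∷ʳ ⊆-tabulate₁ (λ j → w (suc j)) wi

⊆-tabulate₂ : (w : Fin m → A) {x y : A} {i j : Fin m} → i <ᶠ j →
              w i ≡ x → w j ≡ y → x ∷ y ∷ [] ⊆ tabulate w
⊆-tabulate₂ w {i = zero}  {suc j} _         wi wj = ≡.sym wi ∷ ⊆-tabulate₁ (λ j → w (suc j)) wj
⊆-tabulate₂ w {i = suc i} {suc j} (s≤s i<j) wi wj =
  w zero ∷ʳ ⊆-tabulate₂ (λ j → w (suc j)) i<j wi wj

⊆-tabulate₃ : (w : Fin m → A) {x y z : A} {i j l : Fin m} → i <ᶠ j → j <ᶠ l →
              w i ≡ x → w j ≡ y → w l ≡ z → x ∷ y ∷ z ∷ [] ⊆ tabulate w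
⊆-tabulate₃ w {i = zero}  {suc j} {suc l} _         j<l wi wj wl =
  ≡.sym wi ∷ ⊆-tabulate₂ (λ j → w (suc j)) (≤-pred j<l) wj wl
⊆-tabulate₃ w {i = suc i} {suc j} {suc l} (s≤s i<j) (s≤s j<l) wi wj wl =
  w zero ∷ʳ ⊆-tabulate₃ (λ j → w (suc j)) i<j j<l wi wj wl

∈ab⇒kept : {a b x : Fin s} → x ≡ a ⊎ x ≡ b → ((x == a) ∨ (x == b)) ≡ true
∈ab⇒kept {a = a}     (inj₁ refl) rewrite ==-refl a = refl
∈ab⇒kept {b = b} {x} (inj₂ refl) rewrite ==-refl b = ∨-zeroʳ (x == _)

⊆-restrict2 : (a b : Fin s) {xs ys : List (Fin s)} → xs ⊆ ys →
              All (λ x → x ≡ a ⊎ x ≡ b) xs → xs ⊆ restrict2 ys a b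
⊆-restrict2 a b [] [] = []
⊆-restrict2 a b (y ∷ʳ sub) xs∈ab with (y == a) ∨ (y == b)
... | true  = y ∷ʳ ⊆-restrict2 a b sub xs∈ab
... | false = ⊆-restrict2 a b sub xs∈ab
⊆-restrict2 a b (_∷_ {x = x} refl sub) (x∈ab ∷ xs∈ab)
  with (x == a) ∨ (x == b) | ∈ab⇒kept x∈ab
... | true | _ = refl ∷ ⊆-restrict2 a b sub xs∈ab

OccursBefore : (Fin m → Fin s) → Fin s → Fin s → Set
OccursBefore w c d = ∃₂ λ i j → i <ᶠ j × w i ≡ c × w j ≡ d

single-runs⇒¬interleaved : (w : Fin m → Fin s) {a b : Fin s} → a ≢ b →
  runs a (restrict2 (tabulate w) a b) ≡ 1 → runs b (restrict2 (tabulate w) a b) ≡ 1 →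
  OccursBefore w a b → ¬ OccursBefore w b a
single-runs⇒¬interleaved w {a} {b} a≢b ra rb (i , j , i<j , wi , wj) (i′ , j′ , i′<j′ , wi′ , wj′)
  with <-cmp i i′
... | tri< i<i′ _ _ = single-run⇒¬cdc⊆ ra (≢-sym a≢b)
      (⊆-restrict2 a b (⊆-tabulate₃ w i<i′ i′<j′ wi wi′ wj′) (inj₁ refl ∷ inj₂ refl ∷ inj₁ refl ∷ []))
... | tri≈ _ i≡i′ _ = a≢b (trans (≡.sym wi) (trans (cong w i≡i′) wi′))
... | tri> _ _ i′<i = single-run⇒¬cdc⊆ rb a≢b
      (⊆-restrict2 a b (⊆-tabulate₃ w i′<i i<j wi′ wi wj) (inj₂ refl ∷ inj₁ refl ∷ inj₂ refl ∷ []))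

letterAdj-uniform : (D : Fin s → Fin s → Bool) (w : Fin m → Fin s) {a b : Fin s} →
  a ≢ b → (OccursBefore w a b → ¬ OccursBefore w b a) →
  {i j i′ j′ : Fin m} → w i ≡ a → w j ≡ b → w i′ ≡ a → w j′ ≡ b →
  LetterAdj D w i j → LetterAdj D w i′ j′
letterAdj-uniform D w a≢b sep {i} {j} {i′} {j′} refl refl wi′ wj′ ij with ij | <-cmp i′ j′
... | _ | tri≈ _ i′≡j′ _ = ⊥-elim (a≢b (trans (≡.sym wi′) (trans (cong w i′≡j′) wj′)))
... | inj₁ (i<j , d) | tri< i′<j′ _ _ = inj₁ (i′<j′ , trans (cong₂ D wi′ wj′) d)
... | inj₁ (i<j , _) | tri> _ _ j′<i′ = ⊥-elim (sep (i , j , i<j , refl , refl) (j′ , i′ , j′<i′ , wj′ , wi′))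
... | inj₂ (j<i , _) | tri< i′<j′ _ _ = ⊥-elim (sep (i′ , j′ , i′<j′ , wi′ , wj′) (j , i , j<i , refl , refl))
... | inj₂ (j<i , d) | tri> _ _ j′<i′ = inj₂ (j′<i′ , trans (cong₂ D wj′ wi′) d)

lemma4 : (I : Instance) (a b : Fin (Instance.k I)) →
    OneSided I a b →
    runs a (restrict2 (wordList (Instance.w I)) a b) ≡ 1 →
    runs b (restrict2 (wordList (Instance.w I)) a b) ≡ 1 →
    ¬ HasSolution I
lemma4 I a b (a≢b , has-edge , lacks-edge) ra rb (D , f , iso , col)
  with edgesBetween-pos⇒edge (G I) (χ I) a b has-edge
     | edgesBetween<⇒non-edge (G I) (χ I) a b lacks-edge
... | u , v , χu , χv , uv | u′ , v′ , χu′ , χv′ , ¬u′v′ = case trans (≡.sym u′v′) ¬u′v′ of λ ()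
  where
    open Inverse f using (to)
    coloured : ∀ {x c} → χ I x ≡ c → w I (to x) ≡ c
    coloured = trans (col _)
    u′v′ : adj (G I) u′ v′ ≡ true
    u′v′ = Equivalence.from (iso u′ v′)
      (letterAdj-uniform D (w I) a≢b (single-runs⇒¬interleaved (w I) a≢b ra rb)
        (coloured χu) (coloured χv) (coloured χu′) (coloured χv′)
        (Equivalence.to (iso u v) uv))
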